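{- Let $\Sigma$ be a combinator (a term built from the constants $\mathbf{K}$ and $\mathbf{S}$ by application, with no variables) such that $\Sigma x \rhd^\star x$ for a variable $x$. Then in the Engeler model $\mathcal{D}$, $[\![\mathbf{I}]\!] \subseteq [\![\Sigma]\!]$, where $[\![\mathbf{I}]\!] = \{(\{t\}\rightarrowtail t) : t \in \mathcal{G}\}$.
   Context: Combinatory logic terms are built from variables $x_0,x_1,\ldots$ and the constants $\mathbf{K},\mathbf{S}$ by application $(X\cdot Y)$, written $XY$, associating to the left. The rewriting rules are $\mathbf{K}xy \rhd x$ and $\mathbf{S}xyz \rhd xz(yz)$ (applied to subterms in the usual way), and $\rhd^\star$ is the reflexive transitive closure of $\rhd$. A combinator is a term with no variables. The Engeler model: write $(a\rightarrowtail b)$ for the ordered pair $(a,b)$. Let $G_0=\{0,1,2,\ldots\}$, $G_{n+1}=G_n\cup\{(\alpha\rightarrowtail b): \alpha\subseteq G_n \text{ finite}, b\in G_n\}$, and $\mathcal{G}=\bigcup_{n\ge 0}G_n$. The model $\mathcal{D}$ has underlying set the power set of $\mathcal{G}$ with the binary operation $M\bullet N=\{s : \text{there is a finite }\alpha\subseteq N \text{ with } (\alpha\rightarrowtail s)\in M\}$. Interpretations: $[\![\mathbf{K}]\!]=\{(\{t\}\rightarrowtail(\emptyset\rightarrowtail t)) : t\in\mathcal{G}\}$; $[\![\mathbf{S}]\!]$ is the set of all elements $\{\tau\rightarrowtail(\{r_1,\ldots,r_n\}\rightarrowtail s)\}\rightarrowtail\big(\{\sigma_1\rightarrowtail r_1,\ldots,\sigma_n\rightarrowtail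 r_n\}\rightarrowtail(\sigma\rightarrowtail s)\big)$ with $n\ge 0$, $r_1,\ldots,r_n,s\in\mathcal{G}$, $\tau,\sigma_1,\ldots,\sigma_n$ finite subsets of $\mathcal{G}$, and $\sigma=\tau\cup\bigcup_i\sigma_i$; and $[\![X\cdot Y]\!]=[\![X]\!]\bullet[\![Y]\!]$. -}

module Defs where

open import Data.Nat using (ℕ)
open import Data.List using (List; []; _∷_; [_]; _++_; map; concatMap)
open import Data.List.Relation.Unary.All using (All)
open import Data.List.Relation.Unary.Any using (Any)
open import Data.Product using (Σ; _×_; _,_; proj₁; proj₂; ∃)
open import Relation.Binary.Construct.Closure.ReflexiveTransitive using (Star)

infixl 9 _·_

data Term : Set where
  var : ℕ → Term
  K S : Term
  _·_ : Term → Term → Term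

infix 4 _▷_ _▷*_
data _▷_ : Term → Term → Set where
  ▷K  : ∀ x y → K · x · y ▷ x
  ▷S  : ∀ x y z → S · x · y · z ▷ x · z · (y · z)
  ▷appˡ : ∀ {X X′} Y → X ▷ X′ → X · Y ▷ X′ · Y
  ▷appʳ : ∀ X {Y Y′} → Y ▷ Y′ → X · Y ▷ X · Y′

_▷*_ : Term → Term → Set
_▷*_ = Star _▷_

infixl 9 _∙_
data Comb : Set where
  Kc Sc : Comb
  _∙_ : Comb → Comb → Comb

⌜_⌝ : Comb → Term
⌜ Kc ⌝ = K
⌜ Sc ⌝ = S
⌜ X ∙ Y ⌝ = ⌜ X ⌝ · ⌜ Y ⌝

-- Finite subsets are represented by lists;
-- elements are identified up to the equivalence _≈_ below, under which
-- two lists are equal iff they denote the same finite set.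

infixr 5 _↣_
data 𝒢 : Set where
  atom : ℕ → 𝒢
  _↣_  : List 𝒢 → 𝒢 → 𝒢

infix 4 _≈_
data _≈_ : 𝒢 → 𝒢 → Set where
  atom≈ : ∀ n → atom n ≈ atom n
  ↣≈ : ∀ {α β b c} →
       All (λ x → Any (λ y → x ≈ y) β) α →
       All (λ y → Any (λ x → x ≈ y) α) β →
       b ≈ c → (α ↣ b) ≈ (β ↣ c)

𝒫 : Set₁
𝒫 = 𝒢 → Set

infixl 9 _•_
_•_ : 𝒫 → 𝒫 → 𝒫
(M • N) s = Σ (List 𝒢) λ α → All N α × M (α ↣ s)

⟦K⟧ : 𝒫
⟦K⟧ x = Σ 𝒢 λ t → x ≈ ([ t ] ↣ ([] ↣ t))

-- ⟦S⟧ : elements {τ ↣ ({r₁..rₙ} ↣ s)} ↣ ({σ₁ ↣ r₁,..,σₙ ↣ rₙ} ↣ (σ ↣ s)),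
-- σ = τ ∪ ⋃ σᵢ; the list ps = [(σ₁ , r₁), …, (σₙ , rₙ)]   (up to ≈)
⟦S⟧ : 𝒫
⟦S⟧ x = Σ (List 𝒢) λ τ → Σ (List (List 𝒢 × 𝒢)) λ ps → Σ 𝒢 λ s →
  x ≈ ([ τ ↣ (map proj₂ ps ↣ s) ]
        ↣ (map (λ p → proj₁ p ↣ proj₂ p) ps
            ↣ ((τ ++ concatMap proj₁ ps) ↣ s)))

⟦_⟧ : Comb → 𝒫
⟦ Kc ⟧ = ⟦K⟧
⟦ Sc ⟧ = ⟦S⟧
⟦ X ∙ Y ⟧ = ⟦ X ⟧ • ⟦ Y ⟧

⟦I⟧ : 𝒫
⟦I⟧ x = Σ 𝒢 λ t → x ≈ ([ t ] ↣ t)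

infix 4 _⊆_
_⊆_ : 𝒫 → 𝒫 → Set
M ⊆ N = ∀ x → M x → N x

{-# OPTIONS --safe #-}
-- If X ▷* Y then ⟦ Y ⟧ ⊆ ⟦ X ⟧ under every interpretation of the variables, and
-- ⟦ X ⟧ ⊆ ⟦ Y ⟧ under interpretations closed under ≈ (the model only determines
-- ⟦K⟧ and ⟦S⟧ up to ≈).  Interpreting x as {t}, the first inclusion applied to
-- Σ x ▷* x puts some α ↣ t into ⟦ Σ ⟧ with α a list of copies of t.  The list is
-- not empty: otherwise t ∈ ⟦ Σ x ⟧ also when x is interpreted as ∅, and the second
-- inclusion would put t into ∅.  So α ≈ {t}, and {t} ↣ t ∈ ⟦ Σ ⟧.
module Submission where

open import Defs
open import Data.Nat using (ℕ)
open import Data.Empty using (⊥; ⊥-elim)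
open import Relation.Nullary using (¬_)
open import Data.List using (List; []; _∷_; [_]; _++_; map; concatMap)
open import Data.List.Relation.Unary.All as All using (All; []; _∷_)
open import Data.List.Relation.Unary.All.Properties using (++⁺; ++⁻)
open import Data.List.Relation.Unary.Any as Any using (Any; here; there)
open import Data.Product using (∃; _×_; _,_; proj₁; proj₂; uncurry)
open import Function using (flip; _∘_)
open import Relation.Binary.Definitions using (_Respects_)
open import Relation.Binary.PropositionalEquality using (_≡_; refl; sym; cong; cong₂; subst)
open import Relation.Binary.Construct.Closure.ReflexiveTransitive using (ε; _◅_)

module _ {A : Set} where

  Cover : (A → A → Set) → List A → List A → Set
  Cover R α β = All (λ x → Any (R x) β) α

  SymmetricAt : (A → A → Set) → A → Set
  SymmetricAt R x = ∀ {y} → R x y → R y x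

  TransitiveAt : (A → A → Set) → A → Set
  TransitiveAt R y = ∀ {x z} → R x y → R y z → R x z

  Any-zipWithAll : {P Q Q′ : A → Set} {xs : List A} →
                   (∀ {x} → P x → Q x → Q′ x) → All P xs → Any Q xs → Any Q′ xs
  Any-zipWithAll f (p ∷ _)  (here q)  = here (f p q)
  Any-zipWithAll f (_ ∷ ps) (there q) = there (Any-zipWithAll f ps q)

  module _ {R : A → A → Set} where

    Cover-refl : ∀ {α} → All (λ x → R x x) α → Cover R α α
    Cover-refl rs = All.tabulate λ x∈α → Any.map (λ { refl → All.lookup rs x∈α }) x∈α

    Cover-flip : ∀ {α β} → All (SymmetricAt R) α → Cover R α β → Cover (flip R) α β
    Cover-flip syms c = All.zipWith (λ (s , xβ) → Any.map (λ r → s r) xβ) (syms , c)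

    Cover-unflip : ∀ {α β} → All (SymmetricAt R) β → Cover (flip R) α β → Cover R α β
    Cover-unflip syms = All.map (Any-zipWithAll (λ s r → s r) syms)

    Cover-trans : ∀ {α β γ} → All (TransitiveAt R) β → Cover R α β → Cover R β γ → Cover R α γ
    Cover-trans trans c d =
      All.map (All.lookupWith (λ (t , yγ) xy → Any.map (t xy) yγ) (All.zip (trans , d))) c

    Cover-respects : ∀ {P : A → Set} {α β} → P Respects R → All P β → Cover (flip R) α β → All P α
    Cover-respects resp ps = All.map (All.lookupWith (λ p yx → resp yx p) ps)

    TransitiveAt-flip : ∀ {y} → TransitiveAt R y → TransitiveAt (flip R) y
    TransitiveAt-flip t yx zy = t zy yx

module _ {P : 𝒢 → Set} (atomᴾ : ∀ n → P (atom n))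
         (↣ᴾ : ∀ {α b} → All P α → P b → P (α ↣ b)) where

  𝒢-ind : ∀ x → P x
  𝒢-ind* : ∀ α → All P α

  𝒢-ind (atom n) = atomᴾ n
  𝒢-ind (α ↣ b)  = ↣ᴾ (𝒢-ind* α) (𝒢-ind b)

  𝒢-ind* []      = []
  𝒢-ind* (x ∷ α) = 𝒢-ind x ∷ 𝒢-ind* α

≈-refl : ∀ {x} → x ≈ x
≈-refl {x} = 𝒢-ind atom≈ (λ rs r → ↣≈ (Cover-refl rs) (Cover-refl rs) r) x

≈-sym : ∀ {x y} → x ≈ y → y ≈ x
≈-sym {x} = 𝒢-ind {SymmetricAt _≈_} atom-sym ↣-sym x
  where
  atom-sym : ∀ n → SymmetricAt _≈_ (atom n)
  atom-sym n (atom≈ n) = atom≈ n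

  ↣-sym : ∀ {α b} → All (SymmetricAt _≈_) α → SymmetricAt _≈_ b → SymmetricAt _≈_ (α ↣ b)
  ↣-sym ss s (↣≈ c d e) = ↣≈ (Cover-unflip ss d) (Cover-flip ss c) (s e)

-- Induction on the middle element: its list supplies the intermediate witnesses
-- of both coverage conditions.
≈-trans : ∀ {x y z} → x ≈ y → y ≈ z → x ≈ z
≈-trans {y = y} = 𝒢-ind {TransitiveAt _≈_} atom-trans ↣-trans y
  where
  atom-trans : ∀ n → TransitiveAt _≈_ (atom n)
  atom-trans n (atom≈ n) (atom≈ n) = atom≈ n

  ↣-trans : ∀ {β c} → All (TransitiveAt _≈_) β → TransitiveAt _≈_ c → TransitiveAt _≈_ (β ↣ c)
  ↣-trans ts t (↣≈ c₁ d₁ e) (↣≈ c₂ d₂ f) =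
    ↣≈ (Cover-trans ts c₁ c₂) (Cover-trans (All.map TransitiveAt-flip ts) d₂ d₁) (t e f)

↣-congʳ : ∀ α {b c} → b ≈ c → (α ↣ b) ≈ (α ↣ c)
↣-congʳ α = ↣≈ (Cover-refl refls) (Cover-refl refls)
  where
  refls : All (λ x → x ≈ x) α
  refls = All.tabulate λ _ → ≈-refl

Env : Set₁
Env = ℕ → 𝒫

⟦_⟧ₜ : Term → Env → 𝒫
⟦ var n ⟧ₜ ρ = ρ n
⟦ K ⟧ₜ     ρ = ⟦K⟧
⟦ S ⟧ₜ     ρ = ⟦S⟧
⟦ X · Y ⟧ₜ ρ = ⟦ X ⟧ₜ ρ • ⟦ Y ⟧ₜ ρ

⟦⌜⌝⟧ : ∀ X ρ → ⟦ ⌜ X ⌝ ⟧ₜ ρ ≡ ⟦ X ⟧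
⟦⌜⌝⟧ Kc      ρ = refl
⟦⌜⌝⟧ Sc      ρ = refl
⟦⌜⌝⟧ (X ∙ Y) ρ = cong₂ _•_ (⟦⌜⌝⟧ X ρ) (⟦⌜⌝⟧ Y ρ)

⊆-refl : ∀ {M} → M ⊆ M
⊆-refl _ m = m

•-mono : ∀ {M M′ N N′} → M ⊆ M′ → N ⊆ N′ → M • N ⊆ M′ • N′
•-mono M⊆M′ N⊆N′ s (α , αN , m) = α , All.map (N⊆N′ _) αN , M⊆M′ _ m

-- ps pairs each rᵢ with the σᵢ witnessing rᵢ ∈ M • N, matching the shape of ⟦S⟧.
All-•⁻ : ∀ {M N rs} → All (M • N) rs →
         ∃ λ ps → map proj₂ ps ≡ rs × All M (map (uncurry _↣_) ps) × All N (concatMap proj₁ ps)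
All-•⁻ [] = [] , refl , [] , []
All-•⁻ {rs = r ∷ _} ((σ , σN , m) ∷ rest) with All-•⁻ rest
... | ps , refl , ms , ns = (σ , r) ∷ ps , refl , m ∷ ms , ++⁺ σN ns

All-•⁺ : ∀ {M N} ps → All M (map (uncurry _↣_) ps) → All N (concatMap proj₁ ps) →
         All (M • N) (map proj₂ ps)
All-•⁺ []             []       _  = []
All-•⁺ ((σ , r) ∷ ps) (m ∷ ms) ns with ++⁻ σ ns
... | σN , rest = (σ , σN , m) ∷ All-•⁺ ps ms rest

▷⇒⊇ : ∀ {X Y} ρ → X ▷ Y → ⟦ Y ⟧ₜ ρ ⊆ ⟦ X ⟧ₜ ρ
▷⇒⊇ ρ (▷K x y) s s∈x = [] , [] , [ s ] , s∈x ∷ [] , s , ≈-refl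
▷⇒⊇ ρ (▷S x y z) s (rs , rs∈yz , τ , τ∈z , xτ) with All-•⁻ rs∈yz
... | ps , refl , arrows∈y , σs∈z =
  τ ++ concatMap proj₁ ps , ++⁺ τ∈z σs∈z ,
  map (uncurry _↣_) ps , arrows∈y ,
  [ τ ↣ (map proj₂ ps ↣ s) ] , xτ ∷ [] , τ , ps , s , ≈-refl
▷⇒⊇ ρ (▷appˡ Y r) = •-mono (▷⇒⊇ ρ r) (⊆-refl {⟦ Y ⟧ₜ ρ})
▷⇒⊇ ρ (▷appʳ X r) = •-mono (⊆-refl {⟦ X ⟧ₜ ρ}) (▷⇒⊇ ρ r)

▷*⇒⊇ : ∀ {X Y} ρ → X ▷* Y → ⟦ Y ⟧ₜ ρ ⊆ ⟦ X ⟧ₜ ρ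
▷*⇒⊇ ρ ε        = ⊆-refl
▷*⇒⊇ ρ (r ◅ rs) s = ▷⇒⊇ ρ r s ∘ ▷*⇒⊇ ρ rs s

⟦K⟧-resp-≈ : ⟦K⟧ Respects _≈_
⟦K⟧-resp-≈ x≈y (t , x≈k) = t , ≈-trans (≈-sym x≈y) x≈k

⟦S⟧-resp-≈ : ⟦S⟧ Respects _≈_
⟦S⟧-resp-≈ x≈y (τ , ps , s , x≈s) = τ , ps , s , ≈-trans (≈-sym x≈y) x≈s

•-resp-≈ : ∀ {M N} → M Respects _≈_ → (M • N) Respects _≈_
•-resp-≈ M-resp s≈t (α , αN , m) = α , αN , M-resp (↣-congʳ α s≈t) m

⟦_⟧ₜ-resp-≈ : ∀ X {ρ} → (∀ n → ρ n Respects _≈_) → ⟦ X ⟧ₜ ρ Respects _≈_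
⟦ var n ⟧ₜ-resp-≈ ρ-resp = ρ-resp n
⟦ K ⟧ₜ-resp-≈     ρ-resp = ⟦K⟧-resp-≈
⟦ S ⟧ₜ-resp-≈     ρ-resp = ⟦S⟧-resp-≈
⟦ X · Y ⟧ₜ-resp-≈ ρ-resp = •-resp-≈ {N = ⟦ Y ⟧ₜ _} (⟦ X ⟧ₜ-resp-≈ ρ-resp)

⟦_⟧-resp-≈ : ∀ X → ⟦ X ⟧ Respects _≈_
⟦ Kc ⟧-resp-≈    = ⟦K⟧-resp-≈
⟦ Sc ⟧-resp-≈    = ⟦S⟧-resp-≈
⟦ X ∙ Y ⟧-resp-≈ = •-resp-≈ {N = ⟦ Y ⟧} ⟦ X ⟧-resp-≈

▷⇒⊆ : ∀ {X Y ρ} → (∀ n → ρ n Respects _≈_) → X ▷ Y → ⟦ X ⟧ₜ ρ ⊆ ⟦ Y ⟧ₜ ρ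
▷⇒⊆ ρ-resp (▷K x y) s (_ , _ , α , α∈x , t , ↣≈ _ t∈α (↣≈ _ _ s≈t))
  with Cover-respects (⟦ x ⟧ₜ-resp-≈ ρ-resp) α∈x t∈α
... | t∈x ∷ [] = ⟦ x ⟧ₜ-resp-≈ ρ-resp (≈-sym s≈t) t∈x
▷⇒⊆ ρ-resp (▷S x y z) s (γ , γ∈z , β , β∈y , α , α∈x , τ , ps , s′ ,
                         ↣≈ _ xτ∈α (↣≈ _ arrows∈β (↣≈ _ σ∈γ s≈s′)))
  with Cover-respects (⟦ x ⟧ₜ-resp-≈ ρ-resp) α∈x xτ∈α
     | ++⁻ τ (Cover-respects (⟦ z ⟧ₜ-resp-≈ ρ-resp) γ∈z σ∈γ)
... | xτ ∷ [] | τ∈z , σs∈z =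
  map proj₂ ps ,
  All-•⁺ ps (Cover-respects (⟦ y ⟧ₜ-resp-≈ ρ-resp) β∈y arrows∈β) σs∈z ,
  τ , τ∈z ,
  ⟦ x ⟧ₜ-resp-≈ ρ-resp (↣-congʳ τ (↣-congʳ (map proj₂ ps) (≈-sym s≈s′))) xτ
▷⇒⊆ ρ-resp (▷appˡ Y r) = •-mono (▷⇒⊆ ρ-resp r) (⊆-refl {⟦ Y ⟧ₜ _})
▷⇒⊆ ρ-resp (▷appʳ X r) = •-mono (⊆-refl {⟦ X ⟧ₜ _}) (▷⇒⊆ ρ-resp r)

▷*⇒⊆ : ∀ {X Y ρ} → (∀ n → ρ n Respects _≈_) → X ▷* Y → ⟦ X ⟧ₜ ρ ⊆ ⟦ Y ⟧ₜ ρ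
▷*⇒⊆ ρ-resp ε        = ⊆-refl
▷*⇒⊆ ρ-resp (r ◅ rs) s = ▷*⇒⊆ ρ-resp rs s ∘ ▷⇒⊆ ρ-resp r s

copies↣≈singleton↣ : ∀ {a as t b} → All (_≡ t) (a ∷ as) → ((a ∷ as) ↣ b) ≈ ([ t ] ↣ b)
copies↣≈singleton↣ copies@(refl ∷ _) =
  ↣≈ (All.map (λ { refl → here ≈-refl }) copies) (here ≈-refl ∷ []) ≈-refl

module _ (Σ′ : Comb) (Σ′x▷*x : ⌜ Σ′ ⌝ · var 0 ▷* var 0) where

  ⟦⌜Σ′⌝·x⟧ : ∀ ρ → ⟦ ⌜ Σ′ ⌝ · var 0 ⟧ₜ ρ ≡ ⟦ Σ′ ⟧ • ρ 0
  ⟦⌜Σ′⌝·x⟧ ρ = cong (_• ρ 0) (⟦⌜⌝⟧ Σ′ ρ)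

  ∅↣∉⟦Σ′⟧ : ∀ t → ¬ ⟦ Σ′ ⟧ ([] ↣ t)
  ∅↣∉⟦Σ′⟧ t m = ▷*⇒⊆ {ρ = λ _ _ → ⊥} (λ _ _ ()) Σ′x▷*x t t∈Σ′∅
    where
    t∈Σ′∅ : ⟦ ⌜ Σ′ ⌝ · var 0 ⟧ₜ (λ _ _ → ⊥) t
    t∈Σ′∅ = subst (λ M → M t) (sym (⟦⌜Σ′⌝·x⟧ _)) ([] , [] , m)

  copies↣∈⟦Σ′⟧ : ∀ t → ∃ λ α → All (_≡ t) α × ⟦ Σ′ ⟧ (α ↣ t)
  copies↣∈⟦Σ′⟧ t = subst (λ M → M t) (⟦⌜Σ′⌝·x⟧ _) (▷*⇒⊇ (λ _ → _≡ t) Σ′x▷*x t refl)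

  [t]↣t∈⟦Σ′⟧ : ∀ t → ⟦ Σ′ ⟧ ([ t ] ↣ t)
  [t]↣t∈⟦Σ′⟧ t with copies↣∈⟦Σ′⟧ t
  ... | []    , _      , m = ⊥-elim (∅↣∉⟦Σ′⟧ t m)
  ... | _ ∷ _ , copies , m = ⟦ Σ′ ⟧-resp-≈ (copies↣≈singleton↣ copies) m

theorem4 : (Σ′ : Comb) → ⌜ Σ′ ⌝ · var 0 ▷* var 0 → ⟦I⟧ ⊆ ⟦ Σ′ ⟧
theorem4 Σ′ Σ′x▷*x x (t , x≈[t]↣t) = ⟦ Σ′ ⟧-resp-≈ (≈-sym x≈[t]↣t) ([t]↣t∈⟦Σ′⟧ Σ′ Σ′x▷*x t)
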